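{- Let $N\geq 2$ be an integer, $S\subseteq\{0,1,\dots,N-1\}^n$, $1\leq r<n$, and let $a,b\in\{0,1,\dots,N-1\}^r$ be distinct. For $x\in\{a,b\}$ let \[ T_x:=\{p\in\{0,1,\dots,N-1\}^{n-r}\mid x\times p\in S\}, \] where $x\times p\in\{0,\dots,N-1\}^n$ denotes the concatenation of $x$ and $p$. Then \[ M(S)\geq M(T_a\cap T_b)+1. \]
   Context: For a finite set $S\subseteq\mathbb{Z}^n$, $M(S):=M(\mathrm{Conv}(S))$, where $\mathrm{Conv}(S)$ is the convex hull and, for an integral convex polytope $P\subseteq\mathbb{R}^n$, $M(P)$ is the largest integer $m$ such that there is a unimodular affine transformation $A$ (an affine map $x\mapsto Bx+z$ with $B$ an injective integer $n\times m$ matrix and $z\in\mathbb{Z}^n$) with $A([0,1]^m)\subseteq P$. -}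

module Defs where

open import Data.Nat as ℕ using (ℕ; _∸_; _≤_)
open import Data.Nat.Properties using (m+[n∸m]≡n)
open import Data.Integer as ℤ using (ℤ; +_)
open import Data.Rational as ℚ using (ℚ; 0ℚ; 1ℚ)
open import Data.Fin using (Fin; toℕ)
open import Data.Vec using (Vec; []; _∷_; map; zipWith; replicate; _++_; cast)
open import Data.List using (List; foldr)
open import Data.List.Relation.Unary.All using (All)
import Data.Vec.Relation.Unary.All as VAll
open import Data.Product using (Σ; ∃; _×_; _,_; proj₁; proj₂)
open import Relation.Binary.PropositionalEquality using (_≡_)

ℤtoℚ : ℤ → ℚ
ℤtoℚ z = z ℚ./ 1

gridToℚ : ∀ {N d} → Vec (Fin N) d → Vec ℚ d
gridToℚ = map (λ i → ℤtoℚ (+ toℕ i))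

_+ᵥ_ : ∀ {d} → Vec ℚ d → Vec ℚ d → Vec ℚ d
_+ᵥ_ = zipWith ℚ._+_

_·ᵥ_ : ∀ {d} → ℚ → Vec ℚ d → Vec ℚ d
w ·ᵥ v = map (w ℚ.*_) v

dot : ∀ {m} → Vec ℚ m → Vec ℚ m → ℚ
dot [] [] = 0ℚ
dot (x ∷ xs) (y ∷ ys) = x ℚ.* y ℚ.+ dot xs ys

Matrix : ℕ → ℕ → Set
Matrix d m = Vec (Vec ℤ m) d

dotℤ : ∀ {m} → Vec ℤ m → Vec ℤ m → ℤ
dotℤ [] [] = + 0
dotℤ (x ∷ xs) (y ∷ ys) = x ℤ.* y ℤ.+ dotℤ xs ys

applyℤ : ∀ {d m} → Matrix d m → Vec ℤ m → Vec ℤ d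
applyℤ B u = map (λ row → dotℤ row u) B

applyℚ : ∀ {d m} → Matrix d m → Vec ℚ m → Vec ℚ d
applyℚ B t = map (λ row → dot (map ℤtoℚ row) t) B

InjectiveMatrix : ∀ {d m} → Matrix d m → Set
InjectiveMatrix {d} {m} B = ∀ (u v : Vec ℤ m) → applyℤ B u ≡ applyℤ B v → u ≡ v

GridSet : ℕ → ℕ → Set₁
GridSet N d = Vec (Fin N) d → Set

-- Rational convex hull of a (finite) grid set: q is a convex combination
-- of finitely many points of P with nonnegative rational weights summing to 1.
InConv : ∀ {N d} → GridSet N d → Vec ℚ d → Set
InConv {N} {d} P q =
  Σ (List (ℚ × Vec (Fin N) d)) λ ws →
    All (λ wp → (0ℚ ℚ.≤ proj₁ wp) × P (proj₂ wp)) ws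
    × foldr (λ wp acc → proj₁ wp ℚ.+ acc) 0ℚ ws ≡ 1ℚ
    × foldr (λ wp acc → (proj₁ wp ·ᵥ gridToℚ (proj₂ wp)) +ᵥ acc) (replicate d 0ℚ) ws ≡ q

InUnitCube : ∀ {m} → Vec ℚ m → Set
InUnitCube = VAll.All (λ x → (0ℚ ℚ.≤ x) × (x ℚ.≤ 1ℚ))

CubeFits : ∀ {N d} → GridSet N d → ℕ → Set
CubeFits {N} {d} P m =
  Σ (Matrix d m) λ B → Σ (Vec ℤ d) λ z →
    InjectiveMatrix B
    × (∀ (t : Vec ℚ m) → InUnitCube t → InConv P (applyℚ B t +ᵥ map ℤtoℚ z))

IsM : ∀ {N d} → GridSet N d → ℕ → Set
IsM P m = CubeFits P m × (∀ k → CubeFits P k → k ≤ m)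

concat : ∀ {N r n} → r ≤ n → Vec (Fin N) r → Vec (Fin N) (n ∸ r) → Vec (Fin N) n
concat r≤n x p = cast (m+[n∸m]≡n r≤n) (x ++ p)

Slice : ∀ {N r n} → r ≤ n → GridSet N n → Vec (Fin N) r → GridSet N (n ∸ r)
Slice r≤n S x p = S (concat r≤n x p)

_∩_ : ∀ {N d} → GridSet N d → GridSet N d → GridSet N d
(A ∩ B) p = A p × B p

module Submission where

-- If x ↦ Bx + z embeds the unit cube [0,1]^m into Conv(T_a ∩ T_b), then for every point
-- q of that image both a × q and b × q lie in Conv(S), and so does the segment between
-- them. Adding the direction a − b as a new first column therefore embeds [0,1]^(m+1)
-- into Conv(S) via (t₀, t) ↦ (b + t₀(a − b)) × (Bt + z); the enlarged matrix stays
-- injective because a − b ≠ 0.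

open import Defs
open import Data.Nat using (ℕ; zero; suc; _≤_; _<_; _+_)
open import Data.Nat.Properties using (<⇒≤; +-comm; m+[n∸m]≡n)
open import Data.Fin as Fin using (Fin; toℕ)
open import Data.Fin.Properties using (toℕ-injective)
open import Data.Integer as ℤ using (ℤ; +_; 0ℤ)
import Data.Integer.Properties as ℤP
open import Data.Integer.Tactic.RingSolver using (solve-∀)
open import Data.Rational as ℚ using (ℚ; 0ℚ; 1ℚ)
import Data.Rational.Properties as ℚP
import Data.Rational.Unnormalised as ℚᵘ
import Data.Rational.Unnormalised.Properties as ℚᵘP
open import Data.Rational.Solver using (module +-*-Solver)
open import Data.Vec using (Vec; []; _∷_; map; zipWith; replicate; _++_; cast)
open import Data.Vec.Properties
  using (map-++; map-∘; map-cong; map-const; map-id; map-replicate; zipWith-++;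
         zipWith-assoc; zipWith-identityˡ; ++-injective; ∷-injectiveˡ; ∷-injectiveʳ; cast-is-id)
import Data.Vec.Relation.Unary.All as VAll
open import Data.Vec.Relation.Unary.Any using (Any; here; there)
open import Data.List as List using (List)
open import Data.List.Relation.Unary.All as All using (All)
open import Data.List.Relation.Unary.All.Properties using (++⁺)
open import Data.Empty using (⊥-elim)
open import Data.Product using (_×_; _,_; proj₁; proj₂)
open import Function using (_∘_)
open import Relation.Nullary using (yes; no)
open import Relation.Binary.PropositionalEquality
  using (_≡_; _≢_; refl; sym; trans; cong; cong₂; subst; module ≡-Reasoning)

ℤtoℚ-+ : ∀ x y → ℤtoℚ (x ℤ.+ y) ≡ ℤtoℚ x ℚ.+ ℤtoℚ y
ℤtoℚ-+ x y = ℚP.toℚᵘ-injective (begin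
    ℚ.toℚᵘ (ℤtoℚ (x ℤ.+ y))               ≈⟨ ℚP.toℚᵘ-fromℚᵘ (ℚᵘ.mkℚᵘ (x ℤ.+ y) 0) ⟩
    ℚᵘ.mkℚᵘ (x ℤ.+ y) 0                    ≈⟨ ℚᵘ.*≡* (cong (ℤ._* + 1) (sym (cong₂ ℤ._+_ (ℤP.*-identityʳ x) (ℤP.*-identityʳ y)))) ⟩
    ℚᵘ.mkℚᵘ x 0 ℚᵘ.+ ℚᵘ.mkℚᵘ y 0           ≈⟨ ℚᵘP.+-cong (ℚP.toℚᵘ-fromℚᵘ (ℚᵘ.mkℚᵘ x 0)) (ℚP.toℚᵘ-fromℚᵘ (ℚᵘ.mkℚᵘ y 0)) ⟨
    ℚ.toℚᵘ (ℤtoℚ x) ℚᵘ.+ ℚ.toℚᵘ (ℤtoℚ y)   ≈⟨ ℚP.toℚᵘ-homo-+ (ℤtoℚ x) (ℤtoℚ y) ⟨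
    ℚ.toℚᵘ (ℤtoℚ x ℚ.+ ℤtoℚ y)             ∎)
  where open ℚᵘP.≃-Reasoning

ℤtoℚ-[x-y]+y : ∀ x y → ℤtoℚ (x ℤ.- y) ℚ.+ ℤtoℚ y ≡ ℤtoℚ x
ℤtoℚ-[x-y]+y x y = trans (sym (ℤtoℚ-+ (x ℤ.- y) y)) (cong ℤtoℚ (x-y+y≡x x y))
  where
  x-y+y≡x : ∀ x y → x ℤ.- y ℤ.+ y ≡ x
  x-y+y≡x = solve-∀

segment-identity : ∀ d y t → d ℚ.* t ℚ.+ y ≡ t ℚ.* (d ℚ.+ y) ℚ.+ (1ℚ ℚ.- t) ℚ.* y
segment-identity = solve 3 (λ d y t → d :* t :+ y := t :* (d :+ y) :+ (con 1ℚ :- t) :* y) refl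
  where open +-*-Solver

t+[1-t]≡1 : ∀ t → t ℚ.+ (1ℚ ℚ.- t) ≡ 1ℚ
t+[1-t]≡1 = solve 1 (λ t → t :+ (con 1ℚ :- t) := con 1ℚ) refl
  where open +-*-Solver

t*1+[1-t]*1≡1 : ∀ t → t ℚ.* 1ℚ ℚ.+ (1ℚ ℚ.- t) ℚ.* 1ℚ ≡ 1ℚ
t*1+[1-t]*1≡1 t = trans (cong₂ ℚ._+_ (ℚP.*-identityʳ t) (ℚP.*-identityʳ _)) (t+[1-t]≡1 t)

t≤1⇒0≤1-t : ∀ {t} → t ℚ.≤ 1ℚ → 0ℚ ℚ.≤ 1ℚ ℚ.- t
t≤1⇒0≤1-t {t} t≤1 = subst (ℚ._≤ 1ℚ ℚ.- t) (ℚP.+-inverseʳ t) (ℚP.+-monoˡ-≤ (ℚ.- t) t≤1)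

0≤*-mono : ∀ {p q} → 0ℚ ℚ.≤ p → 0ℚ ℚ.≤ q → 0ℚ ℚ.≤ p ℚ.* q
0≤*-mono {p} {q} 0≤p 0≤q =
  ℚP.nonNegative⁻¹ _ {{ℚP.nonNeg*nonNeg⇒nonNeg p {{ℚ.nonNegative 0≤p}} q {{ℚ.nonNegative 0≤q}}}}

map-∘-cong : ∀ {A B C : Set} {f : B → C} {g : A → B} {h : A → C} {n} →
  (∀ x → f (g x) ≡ h x) → (xs : Vec A n) → map f (map g xs) ≡ map h xs
map-∘-cong {f = f} {g} f∘g≗h xs = trans (sym (map-∘ f g xs)) (map-cong f∘g≗h xs)

module _ {d : ℕ} where

  +ᵥ-assoc : (u v w : Vec ℚ d) → (u +ᵥ v) +ᵥ w ≡ u +ᵥ (v +ᵥ w)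
  +ᵥ-assoc = zipWith-assoc ℚP.+-assoc

  +ᵥ-identityˡ : (v : Vec ℚ d) → replicate d 0ℚ +ᵥ v ≡ v
  +ᵥ-identityˡ = zipWith-identityˡ ℚP.+-identityˡ

  ·ᵥ-zeroˡ : (v : Vec ℚ d) → 0ℚ ·ᵥ v ≡ replicate d 0ℚ
  ·ᵥ-zeroˡ v = trans (map-cong ℚP.*-zeroˡ v) (map-const v 0ℚ)

  ·ᵥ-zeroʳ : ∀ c → c ·ᵥ replicate d 0ℚ ≡ replicate d 0ℚ
  ·ᵥ-zeroʳ c = trans (map-replicate (c ℚ.*_) 0ℚ d) (cong (replicate d) (ℚP.*-zeroʳ c))

  ·ᵥ-identityˡ : (v : Vec ℚ d) → 1ℚ ·ᵥ v ≡ v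
  ·ᵥ-identityˡ v = trans (map-cong ℚP.*-identityˡ v) (map-id v)

  ·ᵥ-assoc : ∀ c w (v : Vec ℚ d) → c ·ᵥ (w ·ᵥ v) ≡ (c ℚ.* w) ·ᵥ v
  ·ᵥ-assoc c w = map-∘-cong (sym ∘ ℚP.*-assoc c w)

·ᵥ-distribˡ : ∀ {d} c (u v : Vec ℚ d) → c ·ᵥ (u +ᵥ v) ≡ (c ·ᵥ u) +ᵥ (c ·ᵥ v)
·ᵥ-distribˡ c []      []      = refl
·ᵥ-distribˡ c (x ∷ u) (y ∷ v) = cong₂ _∷_ (ℚP.*-distribˡ-+ c x y) (·ᵥ-distribˡ c u v)

·ᵥ-distribʳ : ∀ {d} s s′ (v : Vec ℚ d) → (s ·ᵥ v) +ᵥ (s′ ·ᵥ v) ≡ (s ℚ.+ s′) ·ᵥ v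
·ᵥ-distribʳ s s′ []      = refl
·ᵥ-distribʳ s s′ (x ∷ v) = cong₂ _∷_ (sym (ℚP.*-distribʳ-+ x s s′)) (·ᵥ-distribʳ s s′ v)

·ᵥ-++ : ∀ {d e} c (u : Vec ℚ d) (v : Vec ℚ e) → c ·ᵥ (u ++ v) ≡ (c ·ᵥ u) ++ (c ·ᵥ v)
·ᵥ-++ c = map-++ (c ℚ.*_)

+ᵥ-++ : ∀ {d e} (u u′ : Vec ℚ d) (v v′ : Vec ℚ e) → (u ++ v) +ᵥ (u′ ++ v′) ≡ (u +ᵥ u′) ++ (v +ᵥ v′)
+ᵥ-++ u u′ v v′ = zipWith-++ ℚ._+_ u v u′ v′

replicate-++ : ∀ {A : Set} d e (x : A) → replicate (d + e) x ≡ replicate d x ++ replicate e x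
replicate-++ zero    e x = refl
replicate-++ (suc d) e x = cong (x ∷_) (replicate-++ d e x)

WeightedPoints : ℕ → ℕ → Set
WeightedPoints N d = List (ℚ × Vec (Fin N) d)

module _ {N d : ℕ} where

  totalWeight : WeightedPoints N d → ℚ
  totalWeight = List.foldr (λ wp acc → proj₁ wp ℚ.+ acc) 0ℚ

  barycentre : WeightedPoints N d → Vec ℚ d
  barycentre = List.foldr (λ wp acc → (proj₁ wp ·ᵥ gridToℚ (proj₂ wp)) +ᵥ acc) (replicate d 0ℚ)

  totalWeight-++ : ∀ ws vs → totalWeight (ws List.++ vs) ≡ totalWeight ws ℚ.+ totalWeight vs
  totalWeight-++ List.[]             vs = sym (ℚP.+-identityˡ _)
  totalWeight-++ ((w , _) List.∷ ws) vs =
    trans (cong (w ℚ.+_) (totalWeight-++ ws vs)) (sym (ℚP.+-assoc w _ _))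

  barycentre-++ : ∀ ws vs → barycentre (ws List.++ vs) ≡ barycentre ws +ᵥ barycentre vs
  barycentre-++ List.[]       vs = sym (+ᵥ-identityˡ _)
  barycentre-++ (_ List.∷ ws) vs = trans (cong (_ +ᵥ_) (barycentre-++ ws vs)) (sym (+ᵥ-assoc _ _ _))

  scaleWeights : ℚ → WeightedPoints N d → WeightedPoints N d
  scaleWeights c = List.map (λ (w , p) → c ℚ.* w , p)

  totalWeight-scale : ∀ c ws → totalWeight (scaleWeights c ws) ≡ c ℚ.* totalWeight ws
  totalWeight-scale c List.[]             = sym (ℚP.*-zeroʳ c)
  totalWeight-scale c ((w , _) List.∷ ws) =
    trans (cong (ℚ._+_ (c ℚ.* w)) (totalWeight-scale c ws)) (sym (ℚP.*-distribˡ-+ c w _))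

  barycentre-scale : ∀ c ws → barycentre (scaleWeights c ws) ≡ c ·ᵥ barycentre ws
  barycentre-scale c List.[]             = sym (·ᵥ-zeroʳ c)
  barycentre-scale c ((w , p) List.∷ ws) = begin
    ((c ℚ.* w) ·ᵥ gridToℚ p) +ᵥ barycentre (scaleWeights c ws)
      ≡⟨ cong₂ _+ᵥ_ (sym (·ᵥ-assoc c w (gridToℚ p))) (barycentre-scale c ws) ⟩
    (c ·ᵥ (w ·ᵥ gridToℚ p)) +ᵥ (c ·ᵥ barycentre ws)
      ≡⟨ sym (·ᵥ-distribˡ c _ _) ⟩
    c ·ᵥ ((w ·ᵥ gridToℚ p) +ᵥ barycentre ws)
      ∎
    where open ≡-Reasoning

module _ {N r k : ℕ} where

  prefixPoints : Vec (Fin N) r → WeightedPoints N k → WeightedPoints N (r + k)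
  prefixPoints a = List.map (λ (w , p) → w , a ++ p)

  totalWeight-prefix : ∀ a ws → totalWeight (prefixPoints a ws) ≡ totalWeight ws
  totalWeight-prefix a List.[]             = refl
  totalWeight-prefix a ((w , _) List.∷ ws) = cong (ℚ._+_ w) (totalWeight-prefix a ws)

  barycentre-prefix : ∀ a ws →
    barycentre (prefixPoints a ws) ≡ (totalWeight ws ·ᵥ gridToℚ a) ++ barycentre ws
  barycentre-prefix a List.[] =
    trans (replicate-++ r k 0ℚ) (cong (_++ _) (sym (·ᵥ-zeroˡ (gridToℚ a))))
  barycentre-prefix a ((w , p) List.∷ ws) = begin
    (w ·ᵥ gridToℚ (a ++ p)) +ᵥ barycentre (prefixPoints a ws)
      ≡⟨ cong₂ _+ᵥ_ (trans (cong (w ·ᵥ_) (map-++ _ a p)) (·ᵥ-++ w (gridToℚ a) (gridToℚ p)))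
                    (barycentre-prefix a ws) ⟩
    ((w ·ᵥ gridToℚ a) ++ (w ·ᵥ gridToℚ p)) +ᵥ ((totalWeight ws ·ᵥ gridToℚ a) ++ barycentre ws)
      ≡⟨ +ᵥ-++ (w ·ᵥ gridToℚ a) (totalWeight ws ·ᵥ gridToℚ a) (w ·ᵥ gridToℚ p) (barycentre ws) ⟩
    ((w ·ᵥ gridToℚ a) +ᵥ (totalWeight ws ·ᵥ gridToℚ a)) ++ ((w ·ᵥ gridToℚ p) +ᵥ barycentre ws)
      ≡⟨ cong (_++ _) (·ᵥ-distribʳ w _ (gridToℚ a)) ⟩
    ((w ℚ.+ totalWeight ws) ·ᵥ gridToℚ a) ++ ((w ·ᵥ gridToℚ p) +ᵥ barycentre ws)
      ∎
    where open ≡-Reasoning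

InConv-mono : ∀ {N d} {P Q : GridSet N d} → (∀ {v} → P v → Q v) → ∀ {q} → InConv P q → InConv Q q
InConv-mono P⊆Q (ws , nonneg∧P , Σw≡1 , Σwp≡q) =
  ws , All.map (λ (0≤w , Pp) → 0≤w , P⊆Q Pp) nonneg∧P , Σw≡1 , Σwp≡q

InConv-convex : ∀ {N d} {P : GridSet N d} {x y : Vec ℚ d} {t} → 0ℚ ℚ.≤ t → t ℚ.≤ 1ℚ →
  InConv P x → InConv P y → InConv P ((t ·ᵥ x) +ᵥ ((1ℚ ℚ.- t) ·ᵥ y))
InConv-convex {P = P} {t = t} 0≤t t≤1 (ws , ws-ok , Σws≡1 , Σws≡x) (vs , vs-ok , Σvs≡1 , Σvs≡y) =
  scaleWeights t ws List.++ scaleWeights s vs ,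
  ++⁺ (scaled-ok 0≤t ws-ok) (scaled-ok (t≤1⇒0≤1-t t≤1) vs-ok) ,
  trans (totalWeight-++ (scaleWeights t ws) (scaleWeights s vs))
    (trans (cong₂ ℚ._+_ (totalWeight-scale t ws) (totalWeight-scale s vs))
    (trans (cong₂ (λ W V → t ℚ.* W ℚ.+ s ℚ.* V) Σws≡1 Σvs≡1) (t*1+[1-t]*1≡1 t))) ,
  trans (barycentre-++ (scaleWeights t ws) (scaleWeights s vs))
    (cong₂ _+ᵥ_ (trans (barycentre-scale t ws) (cong (t ·ᵥ_) Σws≡x))
                (trans (barycentre-scale s vs) (cong (s ·ᵥ_) Σvs≡y)))
  where
  s = 1ℚ ℚ.- t
  scaled-ok : ∀ {c} → 0ℚ ℚ.≤ c → ∀ {us} → All (λ (w , p) → (0ℚ ℚ.≤ w) × P p) us →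
    All (λ (w , p) → (0ℚ ℚ.≤ w) × P p) (scaleWeights c us)
  scaled-ok 0≤c All.[]                   = All.[]
  scaled-ok 0≤c ((0≤w , Pp) All.∷ us-ok) = (0≤*-mono 0≤c 0≤w , Pp) All.∷ scaled-ok 0≤c us-ok

InConv-prefix : ∀ {N r k} {P : GridSet N (r + k)} (a : Vec (Fin N) r) {q} →
  InConv (λ p → P (a ++ p)) q → InConv P (gridToℚ a ++ q)
InConv-prefix {P = P} a {q} (ws , ws-ok , Σw≡1 , Σwp≡q) =
  prefixPoints a ws , prefixed-ok ws-ok ,
  trans (totalWeight-prefix a ws) Σw≡1 ,
  (begin
    barycentre (prefixPoints a ws)                ≡⟨ barycentre-prefix a ws ⟩
    (totalWeight ws ·ᵥ gridToℚ a) ++ barycentre ws ≡⟨ cong₂ (λ W v → (W ·ᵥ gridToℚ a) ++ v) Σw≡1 Σwp≡q ⟩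
    (1ℚ ·ᵥ gridToℚ a) ++ q                        ≡⟨ cong (_++ q) (·ᵥ-identityˡ (gridToℚ a)) ⟩
    gridToℚ a ++ q                                ∎)
  where
  open ≡-Reasoning
  prefixed-ok : ∀ {us} → All (λ (w , p) → (0ℚ ℚ.≤ w) × P (a ++ p)) us →
    All (λ (w , p) → (0ℚ ℚ.≤ w) × P p) (prefixPoints a us)
  prefixed-ok All.[]           = All.[]
  prefixed-ok (ok All.∷ us-ok) = ok All.∷ prefixed-ok us-ok

toℤ : ∀ {N} → Fin N → ℤ
toℤ i = + toℕ i

direction : ∀ {N r} → Vec (Fin N) r → Vec (Fin N) r → Vec ℤ r
direction a b = zipWith ℤ._-_ (map toℤ a) (map toℤ b)

-- The block matrix ( d 0 ; 0 B ) with d a single column.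
_⊕_ : ∀ {r k m} → Vec ℤ r → Matrix k m → Matrix (r + k) (suc m)
_⊕_ {m = m} d B = map (λ dᵢ → dᵢ ∷ replicate m 0ℤ) d ++ map (0ℤ ∷_) B

dotℤ-zeroˡ : ∀ {m} (u : Vec ℤ m) → dotℤ (replicate m 0ℤ) u ≡ 0ℤ
dotℤ-zeroˡ []      = refl
dotℤ-zeroˡ (x ∷ u) = trans (cong (ℤ._+_ (0ℤ ℤ.* x)) (dotℤ-zeroˡ u)) (ℤP.+-identityʳ _)

dot-zeroˡ : ∀ {m} (t : Vec ℚ m) → dot (map ℤtoℚ (replicate m 0ℤ)) t ≡ 0ℚ
dot-zeroˡ []      = refl
dot-zeroˡ (x ∷ t) = trans (cong₂ ℚ._+_ (ℚP.*-zeroˡ x) (dot-zeroˡ t)) (ℚP.+-identityʳ 0ℚ)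

applyℤ-⊕ : ∀ {r k m} (d : Vec ℤ r) (B : Matrix k m) u₀ u →
  applyℤ (d ⊕ B) (u₀ ∷ u) ≡ map (ℤ._* u₀) d ++ applyℤ B u
applyℤ-⊕ {m = m} d B u₀ u =
  trans (map-++ (λ row → dotℤ row (u₀ ∷ u)) (map (λ dᵢ → dᵢ ∷ replicate m 0ℤ) d) (map (0ℤ ∷_) B))
    (cong₂ _++_
      (map-∘-cong (λ dᵢ → trans (cong (ℤ._+_ (dᵢ ℤ.* u₀)) (dotℤ-zeroˡ u)) (ℤP.+-identityʳ _)) d)
      (map-∘-cong (λ row → ℤP.+-identityˡ (dotℤ row u)) B))

applyℚ-⊕ : ∀ {r k m} (d : Vec ℤ r) (B : Matrix k m) t₀ t →
  applyℚ (d ⊕ B) (t₀ ∷ t) ≡ map (λ dᵢ → ℤtoℚ dᵢ ℚ.* t₀) d ++ applyℚ B t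
applyℚ-⊕ {m = m} d B t₀ t =
  trans (map-++ (λ row → dot (map ℤtoℚ row) (t₀ ∷ t)) (map (λ dᵢ → dᵢ ∷ replicate m 0ℤ) d) (map (0ℤ ∷_) B))
    (cong₂ _++_
      (map-∘-cong (λ dᵢ → trans (cong (ℚ._+_ (ℤtoℚ dᵢ ℚ.* t₀)) (dot-zeroˡ t)) (ℚP.+-identityʳ _)) d)
      (map-∘-cong (λ row → trans (cong (ℚ._+ _) (ℚP.*-zeroˡ t₀)) (ℚP.+-identityˡ _)) B))

direction-nonzero : ∀ {N r} {a b : Vec (Fin N) r} → a ≢ b → Any (_≢ 0ℤ) (direction a b)
direction-nonzero {a = []}    {[]}    a≢b = ⊥-elim (a≢b refl)
direction-nonzero {a = x ∷ a} {y ∷ b} a≢b with x Fin.≟ y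
... | yes refl = there (direction-nonzero (a≢b ∘ cong (x ∷_)))
... | no  x≢y  = here (x≢y ∘ toℕ-injective ∘ ℤP.+-injective ∘ ℤP.i-j≡0⇒i≡j _ _)

map-*-cancelʳ : ∀ {r} {d : Vec ℤ r} {u v} → Any (_≢ 0ℤ) d → map (ℤ._* u) d ≡ map (ℤ._* v) d → u ≡ v
map-*-cancelʳ {d = dᵢ ∷ _} {u} {v} (here dᵢ≢0) eq =
  ℤP.*-cancelˡ-≡ dᵢ u v {{ℤ.≢-nonZero dᵢ≢0}} (∷-injectiveˡ eq)
map-*-cancelʳ (there d≢0) eq = map-*-cancelʳ d≢0 (∷-injectiveʳ eq)

⊕-injective : ∀ {r k m} {d : Vec ℤ r} {B : Matrix k m} →
  Any (_≢ 0ℤ) d → InjectiveMatrix B → InjectiveMatrix (d ⊕ B)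
⊕-injective {d = d} {B} d≢0 B-inj (u₀ ∷ u) (v₀ ∷ v) eq =
  cong₂ _∷_ (map-*-cancelʳ d≢0 top) (B-inj u v bottom)
  where
  top,bottom = ++-injective (map (ℤ._* u₀) d) (map (ℤ._* v₀) d)
    (trans (sym (applyℤ-⊕ d B u₀ u)) (trans eq (applyℤ-⊕ d B v₀ v)))
  top = proj₁ top,bottom
  bottom = proj₂ top,bottom

segment-direction : ∀ {N r} (a b : Vec (Fin N) r) t →
  map (λ dᵢ → ℤtoℚ dᵢ ℚ.* t) (direction a b) +ᵥ map ℤtoℚ (map toℤ b)
    ≡ (t ·ᵥ gridToℚ a) +ᵥ ((1ℚ ℚ.- t) ·ᵥ gridToℚ b)
segment-direction []      []      t = refl
segment-direction (x ∷ a) (y ∷ b) t = cong₂ _∷_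
  (trans (segment-identity (ℤtoℚ (toℤ x ℤ.- toℤ y)) (ℤtoℚ (toℤ y)) t)
         (cong (λ X → t ℚ.* X ℚ.+ _) (ℤtoℚ-[x-y]+y (toℤ x) (toℤ y))))
  (segment-direction a b t)

segment-point : ∀ {N r k m} (a b : Vec (Fin N) r) (B : Matrix k m) (z : Vec ℤ k) t₀ t →
  let q = applyℚ B t +ᵥ map ℤtoℚ z in
  applyℚ (direction a b ⊕ B) (t₀ ∷ t) +ᵥ map ℤtoℚ (map toℤ b ++ z)
    ≡ (t₀ ·ᵥ (gridToℚ a ++ q)) +ᵥ ((1ℚ ℚ.- t₀) ·ᵥ (gridToℚ b ++ q))
segment-point a b B z t₀ t = begin
  applyℚ (direction a b ⊕ B) (t₀ ∷ t) +ᵥ map ℤtoℚ (map toℤ b ++ z)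
    ≡⟨ cong₂ _+ᵥ_ (applyℚ-⊕ (direction a b) B t₀ t) (map-++ ℤtoℚ (map toℤ b) z) ⟩
  (map (λ dᵢ → ℤtoℚ dᵢ ℚ.* t₀) (direction a b) ++ applyℚ B t) +ᵥ (map ℤtoℚ (map toℤ b) ++ map ℤtoℚ z)
    ≡⟨ +ᵥ-++ (map (λ dᵢ → ℤtoℚ dᵢ ℚ.* t₀) (direction a b)) (map ℤtoℚ (map toℤ b)) (applyℚ B t) (map ℤtoℚ z) ⟩
  (map (λ dᵢ → ℤtoℚ dᵢ ℚ.* t₀) (direction a b) +ᵥ map ℤtoℚ (map toℤ b)) ++ q
    ≡⟨ cong₂ _++_ (segment-direction a b t₀) (sym (trans (·ᵥ-distribʳ t₀ _ q)
                    (trans (cong (_·ᵥ q) (t+[1-t]≡1 t₀)) (·ᵥ-identityˡ q)))) ⟩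
  ((t₀ ·ᵥ gridToℚ a) +ᵥ (s₀ ·ᵥ gridToℚ b)) ++ ((t₀ ·ᵥ q) +ᵥ (s₀ ·ᵥ q))
    ≡⟨ sym (+ᵥ-++ (t₀ ·ᵥ gridToℚ a) (s₀ ·ᵥ gridToℚ b) (t₀ ·ᵥ q) (s₀ ·ᵥ q)) ⟩
  ((t₀ ·ᵥ gridToℚ a) ++ (t₀ ·ᵥ q)) +ᵥ ((s₀ ·ᵥ gridToℚ b) ++ (s₀ ·ᵥ q))
    ≡⟨ sym (cong₂ _+ᵥ_ (·ᵥ-++ t₀ (gridToℚ a) q) (·ᵥ-++ s₀ (gridToℚ b) q)) ⟩
  (t₀ ·ᵥ (gridToℚ a ++ q)) +ᵥ (s₀ ·ᵥ (gridToℚ b ++ q))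
    ∎
  where
  open ≡-Reasoning
  q = applyℚ B t +ᵥ map ℤtoℚ z
  s₀ = 1ℚ ℚ.- t₀

CubeFits-mono : ∀ {N d m} {P Q : GridSet N d} → (∀ {v} → P v → Q v) → CubeFits P m → CubeFits Q m
CubeFits-mono P⊆Q (B , z , B-inj , fits) = B , z , B-inj , λ t t∈cube → InConv-mono P⊆Q (fits t t∈cube)

CubeFits-lift : ∀ {N r k m} {S : GridSet N (r + k)} {a b : Vec (Fin N) r} → a ≢ b →
  CubeFits (λ p → S (a ++ p) × S (b ++ p)) m → CubeFits S (suc m)
CubeFits-lift {S = S} {a} {b} a≢b (B , z , B-inj , fits) =
  direction a b ⊕ B , map toℤ b ++ z , ⊕-injective (direction-nonzero a≢b) B-inj , fits′
  where
  fits′ : ∀ t → InUnitCube t → InConv S (applyℚ (direction a b ⊕ B) t +ᵥ map ℤtoℚ (map toℤ b ++ z))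
  fits′ (t₀ ∷ t) ((0≤t₀ , t₀≤1) VAll.∷ t∈cube) =
    subst (InConv S) (sym (segment-point a b B z t₀ t))
      (InConv-convex 0≤t₀ t₀≤1 (InConv-prefix a (InConv-mono proj₁ q∈T))
                               (InConv-prefix b (InConv-mono proj₂ q∈T)))
    where q∈T = fits t t∈cube

CubeFits-lift-cast : ∀ {N r k n m} {S : GridSet N n} {a b : Vec (Fin N) r} (e : r + k ≡ n) → a ≢ b →
  CubeFits (λ p → S (cast e (a ++ p)) × S (cast e (b ++ p))) m → CubeFits S (suc m)
CubeFits-lift-cast {S = S} refl a≢b fits =
  CubeFits-mono (subst S (cast-is-id refl _)) (CubeFits-lift {S = S ∘ cast refl} a≢b fits)

lemma2p3 : (N n r : ℕ) → 2 ≤ N → 1 ≤ r → (r<n : r < n)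
    → (S : GridSet N n) → (a b : Vec (Fin N) r) → a ≢ b
    → (mS mT : ℕ) → IsM S mS
    → IsM (Slice (<⇒≤ r<n) S a ∩ Slice (<⇒≤ r<n) S b) mT
    → mT + 1 ≤ mS
lemma2p3 N n r _ _ r<n S a b a≢b mS mT (_ , mS-maximal) (T-fits , _) =
  subst (_≤ mS) (+-comm 1 mT) (mS-maximal (suc mT) (CubeFits-lift-cast (m+[n∸m]≡n (<⇒≤ r<n)) a≢b T-fits))
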